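{- Let $G$ be a connected unit interval graph on $n$ vertices with lower bounds $\mathrm{lbound}:V(G)\to\mathbb{Q}\cup\{ -\infty\}$, let $\varepsilon=1/K$ with $K\ge n/2$ an integer, and fix a partial order $<$ on $V(G)$ as in the context. For $\mathcal{R},\mathcal{R}'\in\mathfrak{Rep}$, $\mathcal{R}'$ is a predecessor of $\mathcal{R}$ if and only if $\mathcal{R}'$ is obtained from $\mathcal{R}$ by a single left-shifting operation, i.e. there is a vertex $u$ with $\ell'_u=\ell_u-\varepsilon$ and $\ell'_v=\ell_v$ for all $v\ne u$.
   Context: A unit interval representation of $G$ is an assignment of reals $\ell_v$ such that $uv\in E(G)$ iff $|\ell_u-\ell_v|\le 1$; it is an $\varepsilon$-grid representation if every $\ell_v$ is an integer multiple of $\varepsilon$. Vertices $u,v$ are indistinguishable if $N[u]=N[v]$. The partial order $<$ is fixed so that distinct vertices are comparable iff they are not indistinguishable, and $<$ is the left-to-right order of the intervals of some unit interval representation of $G$. $\mathfrak{Rep}$ is the set of all $\varepsilon$-grid representations of $G$ with $\ell_u<\ell_v$ whenever $u<v$ and $\ell_v\ge\mathrm{lbound}(v)$ for all $v$, partially ordered by $\mathcal{R}\le\mathcal{R}'$ iff $\ell_v\le\ell'_v$ for all $v$. $\mathcal{R}'\in\mathfrak{Rep}$ is a predecessor of $\mathcal{R}\in\mathfrak{Rep}$ if $\mathcal{R}'<\mathcal{R}$ and there is no $\bar{\mathcal{R}}\in\mathfrak{Rep}$ with $\mathcal{R}'<\bar{\mathcal{R}}<\mathcal{R}$.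
   Formalization: The unit interval representation of G whose left-to-right order fixes the partial order < has rational rather than real values $\ell_v$. -}

module Defs where

open import Data.Nat using (ℕ; NonZero)
open import Data.Fin using (Fin)
open import Data.Integer using (ℤ; +_)
open import Data.Rational using (ℚ; _/_; _-_; ∣_∣; _≤_; _<_; 1ℚ)
open import Data.Maybe using (Maybe; just; nothing)
open import Data.Unit using (⊤)
open import Data.Product using (Σ; ∃; _×_)
open import Data.Sum using (_⊎_)
open import Relation.Nullary using (¬_)
open import Relation.Binary.PropositionalEquality using (_≡_; _≢_)
open import Function.Bundles using (_⇔_)

record Graph (n : ℕ) : Set₁ where
  field
    Adj    : Fin n → Fin n → Set
    sym    : ∀ {u v} → Adj u v → Adj v u
    irrefl : ∀ {u} → ¬ Adj u u
open Graph public

module _ {n : ℕ} (G : Graph n) where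

  data Reach : Fin n → Fin n → Set where
    here : ∀ {u} → Reach u u
    step : ∀ {u v w} → Adj G u v → Reach v w → Reach u w

  Connected : Set
  Connected = ∀ u v → Reach u v

  InClosedNbhd : Fin n → Fin n → Set
  InClosedNbhd u w = (w ≡ u) ⊎ Adj G u w

  Indistinguishable : Fin n → Fin n → Set
  Indistinguishable u v = ∀ w → InClosedNbhd u w ⇔ InClosedNbhd v w

  -- unit interval representation (positions of left endpoints):
  -- for distinct u, v:  uv ∈ E  iff  |ℓ_u - ℓ_v| ≤ 1
  IsUnitIntervalRep : (Fin n → ℚ) → Set
  IsUnitIntervalRep ℓ = ∀ u v → u ≢ v → (Adj G u v ⇔ (∣ ℓ u - ℓ v ∣ ≤ 1ℚ))

  IsIntervalOrder : (Fin n → Fin n → Set) → Set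
  IsIntervalOrder _≺_ =
    Σ (Fin n → ℚ) λ ℓ₀ → IsUnitIntervalRep ℓ₀ ×
      (∀ u v → (u ≺ v) ⇔ ((¬ Indistinguishable u v) × (ℓ₀ u < ℓ₀ v)))

  module _ (K : ℕ) .{{_ : NonZero K}} where

    ε : ℚ
    ε = (+ 1) / K

    IsGrid : (Fin n → ℚ) → Set
    IsGrid ℓ = ∀ v → ∃ λ (k : ℤ) → ℓ v ≡ k / K

    AboveLBound : Maybe ℚ → ℚ → Set
    AboveLBound nothing  x = ⊤          -- lbound = -∞
    AboveLBound (just b) x = b ≤ x

    InRep : (Fin n → Fin n → Set) → (Fin n → Maybe ℚ) → (Fin n → ℚ) → Set
    InRep _≺_ lbound ℓ =
      IsGrid ℓ × IsUnitIntervalRep ℓ ×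
      (∀ u v → u ≺ v → ℓ u < ℓ v) ×
      (∀ v → AboveLBound (lbound v) (ℓ v))

    _≤ᴿ_ : (Fin n → ℚ) → (Fin n → ℚ) → Set
    ℓ ≤ᴿ ℓ' = ∀ v → ℓ v ≤ ℓ' v

    _<ᴿ_ : (Fin n → ℚ) → (Fin n → ℚ) → Set
    ℓ <ᴿ ℓ' = (ℓ ≤ᴿ ℓ') × ¬ (∀ v → ℓ v ≡ ℓ' v)

    IsPredecessor : (Fin n → Fin n → Set) → (Fin n → Maybe ℚ) →
                    (Fin n → ℚ) → (Fin n → ℚ) → Set
    IsPredecessor _≺_ lbound ℓ' ℓ =
      (ℓ' <ᴿ ℓ) ×
      ¬ (Σ (Fin n → ℚ) λ ℓ̄ → InRep _≺_ lbound ℓ̄ × (ℓ' <ᴿ ℓ̄) × (ℓ̄ <ᴿ ℓ))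

    IsLeftShift : (Fin n → ℚ) → (Fin n → ℚ) → Set
    IsLeftShift ℓ' ℓ =
      ∃ λ u → (ℓ' u ≡ ℓ u - ε) × (∀ v → v ≢ u → ℓ' v ≡ ℓ v)

-- Write ℓ = X / K and ℓ' = X' / K with integer X, X', so that the unit length is K grid steps.
-- A left shift leaves no grid representation strictly in between. Conversely, let ℓ' be a
-- predecessor of ℓ and call v moved if X' v < X v. A moved u can be shifted one step left
-- inside 𝔑𝔢𝔭, above ℓ', unless some w sits at X u + K or X u - (K+1) (a jump from u); a vertex
-- at X u - 1 cannot block, since it would be indistinguishable from u. Jumps from moved
-- vertices land on moved vertices, and every jump changes 2X by -1 modulo 2K+1, so a walk along
-- jumps meets 2K+1 distinct vertices, impossible for n ≤ 2K. Hence some moved u can be shifted,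
-- and minimality of ℓ' forces ℓ' to be that shift.

module Submission where

open import Defs hiding (sym)
open import Data.Nat using (ℕ; NonZero; _≤_; _*_)
open import Data.Fin using (Fin)
open import Data.Rational using (ℚ)
open import Data.Maybe using (Maybe)
open import Function.Bundles using (_⇔_)

open import Data.Nat as ℕ using (suc; zero; z≤n; s≤s; pred; _∸_)
import Data.Nat.Properties as ℕ
open import Data.Nat.Divisibility using (∣⇒≤)
open import Data.Integer as ℤ using (ℤ; +_; +[1+_]; -[1+_]; 1ℤ; -1ℤ; _+_; _-_; -_; _<_; ∣_∣)
  renaming (pred to predℤ)
import Data.Integer.Properties as ℤ
open import Data.Integer.Divisibility.Signed using (_∣_; divides; ∣m∣n⇒∣m+n; ∣m∣n⇒∣m-n; ∣⇒∣ᵤ)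
open import Data.Integer.Tactic.RingSolver using (solve-∀)
open import Data.Rational as ℚ using (_/_; 1ℚ; toℚᵘ)
import Data.Rational.Properties as ℚ
open import Data.Rational.Unnormalised as ℚᵘ using (mkℚᵘ; *≤*; *<*; *≡*)
import Data.Rational.Unnormalised.Properties as ℚᵘ
open import Data.Fin as Fin using (toℕ)
import Data.Fin.Properties as Fin
open import Data.Vec.Functional using (updateAt)
open import Data.Vec.Functional.Properties using (updateAt-updates; updateAt-minimal)
open import Data.Maybe using (just; nothing)
open import Data.Unit using (tt)
open import Data.Sum using (_⊎_; inj₁; inj₂; [_,_]; [_,_]′)
open import Data.Product using (∃-syntax; ∃₂; _×_; _,_; proj₁; proj₂)
open import Data.Empty using (⊥-elim)
open import Function.Base using (_∘_)
open import Function.Bundles using (mk⇔; module Equivalence)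
open import Function.Construct.Identity using (⇔-id)
open import Function.Construct.Symmetry using (⇔-sym)
open import Function.Construct.Composition using (_⇔-∘_)
open import Relation.Nullary using (¬_; Dec; yes; no)
open import Relation.Nullary.Decidable using (_×-dec_; _⊎-dec_; ¬?; decidable-stable)
open import Relation.Binary.Core using (_Preserves_⟶_)
open import Relation.Binary.Definitions using (tri<; tri≈; tri>)
open import Relation.Binary.PropositionalEquality hiding ([_])

-- Grid points a / K

toℚᵘ-/ : ∀ K .{{_ : NonZero K}} a → toℚᵘ (a / K) ℚᵘ.≃ mkℚᵘ a (pred K)
toℚᵘ-/ (suc k) a = ℚ.toℚᵘ-fromℚᵘ (mkℚᵘ a k)

module _ (K : ℕ) .{{_ : NonZero K}} where

  private
    K′ : ℤ
    K′ = +[1+ pred K ]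

    ≃-/ : ∀ a → mkℚᵘ a (pred K) ℚᵘ.≃ toℚᵘ (a / K)
    ≃-/ a = ℚᵘ.≃-sym (toℚᵘ-/ K a)

    common-denominator : ∀ a b d → (a ℤ.* d + - b ℤ.* d) ℤ.* d ≡ (a - b) ℤ.* (d ℤ.* d)
    common-denominator = solve-∀

  /-mono-≤ : ∀ {a b} → a ℤ.≤ b → a / K ℚ.≤ b / K
  /-mono-≤ {a} {b} a≤b = ℚ.toℚᵘ-cancel-≤
    (ℚᵘ.≤-respˡ-≃ (≃-/ a) (ℚᵘ.≤-respʳ-≃ (≃-/ b) (*≤* (ℤ.*-monoʳ-≤-nonNeg K′ a≤b))))

  /-cancel-≤ : ∀ {a b} → a / K ℚ.≤ b / K → a ℤ.≤ b
  /-cancel-≤ {a} {b} p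
    with ℚᵘ.≤-respˡ-≃ (toℚᵘ-/ K a) (ℚᵘ.≤-respʳ-≃ (toℚᵘ-/ K b) (ℚ.toℚᵘ-mono-≤ p))
  ... | *≤* q = ℤ.*-cancelʳ-≤-pos a b K′ q

  /-mono-< : ∀ {a b} → a < b → a / K ℚ.< b / K
  /-mono-< {a} {b} a<b = ℚ.toℚᵘ-cancel-<
    (ℚᵘ.<-respˡ-≃ (≃-/ a) (ℚᵘ.<-respʳ-≃ (≃-/ b) (*<* (ℤ.*-monoʳ-<-pos K′ a<b))))

  /-cancel-< : ∀ {a b} → a / K ℚ.< b / K → a < b
  /-cancel-< {a} {b} p
    with ℚᵘ.<-respˡ-≃ (toℚᵘ-/ K a) (ℚᵘ.<-respʳ-≃ (toℚᵘ-/ K b) (ℚ.toℚᵘ-mono-< p))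
  ... | *<* q = ℤ.*-cancelʳ-<-nonNeg K′ q

  /-injective : ∀ {a b} → a / K ≡ b / K → a ≡ b
  /-injective e = ℤ.≤-antisym (/-cancel-≤ (ℚ.≤-reflexive e)) (/-cancel-≤ (ℚ.≤-reflexive (sym e)))

  /-sub : ∀ a b → a / K ℚ.- b / K ≡ (a - b) / K
  /-sub a b = ℚ.toℚᵘ-injective (begin
    toℚᵘ (a / K ℚ.- b / K)                     ≈⟨ ℚ.toℚᵘ-homo-+ (a / K) (ℚ.- (b / K)) ⟩
    toℚᵘ (a / K) ℚᵘ.+ toℚᵘ (ℚ.- (b / K))       ≈⟨ ℚᵘ.+-cong (toℚᵘ-/ K a) toℚᵘ-neg ⟩
    mkℚᵘ a (pred K) ℚᵘ.+ ℚᵘ.- mkℚᵘ b (pred K)  ≈⟨ *≡* (common-denominator a b K′) ⟩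
    mkℚᵘ (a - b) (pred K)                      ≈⟨ ≃-/ (a - b) ⟩
    toℚᵘ ((a - b) / K)                         ∎)
    where
    open ℚᵘ.≃-Reasoning
    toℚᵘ-neg : toℚᵘ (ℚ.- (b / K)) ℚᵘ.≃ ℚᵘ.- mkℚᵘ b (pred K)
    toℚᵘ-neg = ℚᵘ.≃-trans (ℚ.toℚᵘ-homo‿- (b / K)) (ℚᵘ.-‿cong (toℚᵘ-/ K b))

  /-pred : ∀ a → a / K ℚ.- 1ℤ / K ≡ predℤ a / K
  /-pred a = trans (/-sub a 1ℤ) (cong (_/ K) (ℤ.+-comm a -1ℤ))

  ∣/∣ : ∀ a → ℚ.∣ a / K ∣ ≡ + ∣ a ∣ / K
  ∣/∣ a = ℚ.toℚᵘ-injective (ℚᵘ.≃-trans (ℚ.toℚᵘ-homo-∣-∣ (a / K))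
    (ℚᵘ.≃-trans (ℚᵘ.∣-∣-cong (toℚᵘ-/ K a)) (≃-/ (+ ∣ a ∣))))

  K/K≡1 : + K / K ≡ 1ℚ
  K/K≡1 = ℚ.toℚᵘ-injective (ℚᵘ.≃-trans (toℚᵘ-/ K (+ K))
    (*≡* (trans (ℤ.*-identityʳ (+ K)) (trans (cong +_ (sym (ℕ.suc-pred K))) (sym (ℤ.*-identityˡ K′))))))

  ∣/-/∣≤1⇔∣-∣≤K : ∀ a b → (ℚ.∣ a / K ℚ.- b / K ∣ ℚ.≤ 1ℚ) ⇔ (∣ a - b ∣ ≤ K)
  ∣/-/∣≤1⇔∣-∣≤K a b = mk⇔
    (λ p → ℤ.drop‿+≤+ (/-cancel-≤ (subst₂ ℚ._≤_ distance (sym K/K≡1) p)))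
    (λ p → subst₂ ℚ._≤_ (sym distance) K/K≡1 (/-mono-≤ (ℤ.+≤+ p)))
    where
    distance : ℚ.∣ a / K ℚ.- b / K ∣ ≡ + ∣ a - b ∣ / K
    distance = trans (cong ℚ.∣_∣ (/-sub a b)) (∣/∣ (a - b))

  /-≤⇔ : ∀ {p q a b} → p ≡ a / K → q ≡ b / K → (p ℚ.≤ q) ⇔ (a ℤ.≤ b)
  /-≤⇔ refl refl = mk⇔ /-cancel-≤ /-mono-≤

  /-<⇔ : ∀ {p q a b} → p ≡ a / K → q ≡ b / K → (p ℚ.< q) ⇔ (a < b)
  /-<⇔ refl refl = mk⇔ /-cancel-< /-mono-<

pred<self : ∀ x → predℤ x < x
pred<self x = ℤ.i≤pred[j]⇒i<j ℤ.≤-refl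

between-pred-and-self : ∀ {x z} → predℤ x ℤ.≤ z → z ℤ.≤ x → z ≡ predℤ x ⊎ z ≡ x
between-pred-and-self {x} {z} pred≤z z≤x with z ℤ.≟ x
... | yes z≡x = inj₂ z≡x
... | no z≢x = inj₁ (ℤ.≤-antisym (ℤ.i<j⇒i≤pred[j] (ℤ.≤∧≢⇒< z≤x z≢x)) pred≤z)

∣pred∣≤⇔∣∣≤ : ∀ K d → d ≢ - + K → d ≢ + suc K → (∣ predℤ d ∣ ≤ K) ⇔ (∣ d ∣ ≤ K)
∣pred∣≤⇔∣∣≤ zero    (+ zero) d≢-K _ = ⊥-elim (d≢-K refl)
∣pred∣≤⇔∣∣≤ (suc K) (+ zero) _ _ = mk⇔ (λ _ → z≤n) (λ _ → s≤s z≤n)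
∣pred∣≤⇔∣∣≤ K +[1+ m ] _ d≢1+K =
  mk⇔ (λ m≤K → ℕ.≤∧≢⇒< m≤K (d≢1+K ∘ cong +[1+_])) ℕ.<⇒≤
∣pred∣≤⇔∣∣≤ K -[1+ m ] d≢-K _ =
  mk⇔ ℕ.<⇒≤ (λ 1+m≤K → ℕ.≤∧≢⇒< 1+m≤K (d≢-K ∘ cong (λ k → - + k)))

<+1+ : ∀ x K → x < x + + suc K
<+1+ x K = subst (_< x + + suc K) (ℤ.+-identityʳ x) (ℤ.+-monoʳ-< x (ℤ.+<+ ℕ.z<s))

∣-∣≤⇔<+1+ : ∀ K {x y} → x ℤ.≤ y → (∣ x - y ∣ ≤ K) ⇔ (y < x + + suc K)
∣-∣≤⇔<+1+ K {x} {y} x≤y = mk⇔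
  (λ d≤K → ℤ.i≤pred[j]⇒i<j (subst (y ℤ.≤_) (sym (pred[x+1+k]≡x+k x (+ K)))
    (subst (ℤ._≤ x + + K) (x+[y-x]≡y x y) (ℤ.+-monoʳ-≤ x (y-x≤K d≤K)))))
  (λ y<x+1+K → ℤ.drop‿+≤+ (subst₂ ℤ._≤_ (sym (ℤ.∣-∣-≤ x≤y)) ([x+k]-x≡k x (+ K))
    (ℤ.+-monoˡ-≤ (- x) (subst (y ℤ.≤_) (pred[x+1+k]≡x+k x (+ K)) (ℤ.i<j⇒i≤pred[j] y<x+1+K)))))
  where
  y-x≤K : ∣ x - y ∣ ≤ K → y - x ℤ.≤ + K
  y-x≤K d≤K = subst (ℤ._≤ + K) (ℤ.∣-∣-≤ x≤y) (ℤ.+≤+ d≤K)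
  x+[y-x]≡y : ∀ x y → x + (y - x) ≡ y
  x+[y-x]≡y = solve-∀
  [x+k]-x≡k : ∀ x k → (x + k) - x ≡ k
  [x+k]-x≡k = solve-∀
  pred[x+1+k]≡x+k : ∀ x k → -1ℤ + (x + (1ℤ + k)) ≡ x + k
  pred[x+1+k]≡x+k = solve-∀

-- Jumps

module _ {A : Set} (K : ℕ) (X : A → ℤ) where

  -- Shifting u one step left would lose (X w = X u + K) or gain (X w = X u - (K+1)) the edge uw.
  Jump : A → A → Set
  Jump u v = X v ≡ X u + + K ⊎ X v ≡ X u - + suc K

  jump? : ∀ u w → Dec (Jump u w)
  jump? u w = (X w ℤ.≟ X u + + K) ⊎-dec (X w ℤ.≟ X u - + suc K)

  unblocked-near : ∀ {u} → (∀ w → ¬ Jump u w) →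
                   ∀ w → (∣ predℤ (X u) - X w ∣ ≤ K) ⇔ (∣ X u - X w ∣ ≤ K)
  unblocked-near {u} unblocked w =
    subst (λ d → (∣ d ∣ ≤ K) ⇔ (∣ X u - X w ∣ ≤ K)) (sym (ℤ.pred-+ (X u) (- X w)))
      (∣pred∣≤⇔∣∣≤ K (X u - X w)
        (λ d≡-K → unblocked w (inj₁ (trans (Xw≡Xu-d (- + K) d≡-K) (cong (λ k → X u + k) (ℤ.neg-involutive (+ K))))))
        (λ d≡1+K → unblocked w (inj₂ (Xw≡Xu-d (+ suc K) d≡1+K))))
    where
    Xw≡Xu-d : ∀ d → X u - X w ≡ d → X w ≡ X u - d
    Xw≡Xu-d d refl = sub-sub (X u) (X w)
      where
      sub-sub : ∀ x y → y ≡ x - (x - y)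
      sub-sub = solve-∀

  private
    modulus≡ : 1ℤ + + 2 ℤ.* + K ≡ + suc (2 * K)
    modulus≡ = cong (λ z → 1ℤ + z) (sym (ℤ.pos-* 2 K))

  jump-potential : ∀ {u v} → Jump u v → + suc (2 * K) ∣ (+ 2 ℤ.* X v + 1ℤ) - + 2 ℤ.* X u
  jump-potential {u} (inj₁ eq) rewrite eq = divides 1ℤ (trans (up (X u) (+ K)) (cong (1ℤ ℤ.*_) modulus≡))
    where
    up : ∀ x k → (+ 2 ℤ.* (x + k) + 1ℤ) - + 2 ℤ.* x ≡ 1ℤ ℤ.* (1ℤ + + 2 ℤ.* k)
    up = solve-∀
  jump-potential {u} (inj₂ eq) rewrite eq = divides -1ℤ (trans (down (X u) (+ K)) (cong (-1ℤ ℤ.*_) modulus≡))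
    where
    down : ∀ x k → (+ 2 ℤ.* (x - (1ℤ + k)) + 1ℤ) - + 2 ℤ.* x ≡ -1ℤ ℤ.* (1ℤ + + 2 ℤ.* k)
    down = solve-∀

  -- Doubled, both jump lengths are -1 modulo 2K+1.
  module _ (at : ℕ → A) (jumps : ∀ p → Jump (at p) (at (suc p))) where

    private
      potential : ℕ → ℤ
      potential p = + 2 ℤ.* X (at p) + + p

      potential-invariant : ∀ p → + suc (2 * K) ∣ potential p - potential 0
      potential-invariant zero = divides (+ 0) (ℤ.+-inverseʳ (potential 0))
      potential-invariant (suc p) =
        subst (_ ∣_) (telescope (X (at (suc p))) (X (at p)) (+ p) (potential 0))
          (∣m∣n⇒∣m+n (jump-potential (jumps p)) (potential-invariant p))
        where
        telescope : ∀ y x p c →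
                    ((+ 2 ℤ.* y + 1ℤ) - + 2 ℤ.* x) + ((+ 2 ℤ.* x + p) - c) ≡ (+ 2 ℤ.* y + (1ℤ + p)) - c
        telescope = solve-∀

    return-time : ∀ {i j} → i ℕ.< j → X (at i) ≡ X (at j) → suc (2 * K) ≤ j ∸ i
    return-time {i} {j} i<j same = ∣⇒≤ {{ℕ.>-nonZero (ℕ.m<n⇒0<n∸m i<j)}}
      (∣⇒∣ᵤ (subst (_ ∣_) elapsed (∣m∣n⇒∣m-n (potential-invariant j) (potential-invariant i))))
      where
      cancel : ∀ x a b c → ((+ 2 ℤ.* x + a) - c) - ((+ 2 ℤ.* x + b) - c) ≡ a - b
      cancel = solve-∀
      elapsed : (potential j - potential 0) - (potential i - potential 0) ≡ + (j ∸ i)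
      elapsed = begin
        (potential j - potential 0) - (potential i - potential 0)
          ≡⟨ cong (λ x → (potential j - potential 0) - ((+ 2 ℤ.* x + + i) - potential 0)) same ⟩
        (potential j - potential 0) - ((+ 2 ℤ.* X (at j) + + i) - potential 0)
          ≡⟨ cancel (X (at j)) (+ j) (+ i) (potential 0) ⟩
        + j - + i  ≡⟨ ℤ.m-n≡m⊖n j i ⟩
        j ℤ.⊖ i    ≡⟨ ℤ.⊖-≥ (ℕ.<⇒≤ i<j) ⟩
        + (j ∸ i)  ∎
        where open ≡-Reasoning

jumpClosed-empty : ∀ {n} K (X : Fin n → ℤ) (P : Fin n → Set) → n ≤ 2 * K →
                   (∀ u → P u → ∃[ v ] P v × Jump K X u v) → ∀ u → ¬ P u
jumpClosed-empty {n} K X P n≤2K closed u Pu = no-early-return (Fin.pigeonhole (s≤s n≤2K) (λ i → at (toℕ i)))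
  where
  walk : ℕ → ∃[ v ] P v
  walk zero = u , Pu
  walk (suc p) with closed (proj₁ (walk p)) (proj₂ (walk p))
  ... | v , Pv , _ = v , Pv
  at : ℕ → Fin n
  at p = proj₁ (walk p)
  jumps : ∀ p → Jump K X (at p) (at (suc p))
  jumps p with closed (proj₁ (walk p)) (proj₂ (walk p))
  ... | _ , _ , jump = jump
  no-early-return : ¬ ∃₂ λ (i j : Fin (suc (2 * K))) → i Fin.< j × at (toℕ i) ≡ at (toℕ j)
  no-early-return (i , j , i<j , same) =
    ℕ.<⇒≱ (Fin.toℕ<n j)
      (ℕ.≤-trans (return-time K X at jumps i<j (cong X same)) (ℕ.m∸n≤m (toℕ j) (toℕ i)))

shiftLeft : ∀ {n} → (Fin n → ℤ) → Fin n → Fin n → ℤ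
shiftLeft X u = updateAt X u predℤ

shiftLeft-self : ∀ {n} (X : Fin n → ℤ) u → shiftLeft X u u ≡ predℤ (X u)
shiftLeft-self X u = updateAt-updates u X

shiftLeft-other : ∀ {n} (X : Fin n → ℤ) {u v} → v ≢ u → shiftLeft X u v ≡ X v
shiftLeft-other X {u} {v} = updateAt-minimal v u X

shiftLeft-≤ : ∀ {n} (X : Fin n → ℤ) u v → shiftLeft X u v ℤ.≤ X v
shiftLeft-≤ X u v with v Fin.≟ u
... | yes refl rewrite shiftLeft-self X u = ℤ.<⇒≤ (pred<self (X u))
... | no v≢u rewrite shiftLeft-other X v≢u = ℤ.≤-refl

module _ {n} (K : ℕ) (X : Fin n → ℤ) {u : Fin n} (unblocked : ∀ w → ¬ Jump K X u w) where

  ∣shiftLeft-∣≤⇔∣-∣≤ : ∀ v w → (∣ shiftLeft X u v - shiftLeft X u w ∣ ≤ K) ⇔ (∣ X v - X w ∣ ≤ K)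
  ∣shiftLeft-∣≤⇔∣-∣≤ v w with v Fin.≟ u | w Fin.≟ u
  ... | yes refl | yes refl rewrite ℤ.+-inverseʳ (shiftLeft X u u) | ℤ.+-inverseʳ (X u) = ⇔-id _
  ... | yes refl | no w≢u rewrite shiftLeft-self X u | shiftLeft-other X w≢u = unblocked-near K X unblocked w
  ... | no v≢u | yes refl rewrite shiftLeft-self X u | shiftLeft-other X v≢u
                                | ℤ.∣i-j∣≡∣j-i∣ (X v) (predℤ (X u)) | ℤ.∣i-j∣≡∣j-i∣ (X v) (X u) =
    unblocked-near K X unblocked v
  ... | no v≢u | no w≢u rewrite shiftLeft-other X v≢u | shiftLeft-other X w≢u = ⇔-id _

-- Representations in grid coordinates, with unit length K

module _ {n : ℕ} (G : Graph n) (K : ℕ) where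

  IsScaledRep : (Fin n → ℤ) → Set
  IsScaledRep X = ∀ u v → u ≢ v → Adj G u v ⇔ (∣ X u - X v ∣ ≤ K)

  module _ {X : Fin n → ℤ} (rep : IsScaledRep X) where

    closedNbhd⇔near : ∀ u w → InClosedNbhd G u w ⇔ (∣ X u - X w ∣ ≤ K)
    closedNbhd⇔near u w = mk⇔ to from
      where
      to : InClosedNbhd G u w → ∣ X u - X w ∣ ≤ K
      to (inj₁ refl) = subst (_≤ K) (sym (cong ∣_∣ (ℤ.+-inverseʳ (X u)))) z≤n
      to (inj₂ u~w) = Equivalence.to (rep u w (λ { refl → irrefl G u~w })) u~w
      from : ∣ X u - X w ∣ ≤ K → InClosedNbhd G u w
      from near with w Fin.≟ u
      ... | yes w≡u = inj₁ w≡u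
      ... | no w≢u = inj₂ (Equivalence.from (rep u w (w≢u ∘ sym)) near)

    shiftLeft-isScaledRep : ∀ {u} → (∀ w → ¬ Jump K X u w) → IsScaledRep (shiftLeft X u)
    shiftLeft-isScaledRep unblocked a b a≢b = ⇔-sym (∣shiftLeft-∣≤⇔∣-∣≤ K X unblocked a b) ⇔-∘ rep a b a≢b

    unblocked⇒indistinguishable : ∀ {u a} → (∀ w → ¬ Jump K X u w) → X a ≡ predℤ (X u) →
                                  Indistinguishable G a u
    unblocked⇒indistinguishable {u} {a} unblocked Xa≡ w =
      ⇔-sym (closedNbhd⇔near u w) ⇔-∘ (unblocked-near K X unblocked w ⇔-∘
        subst (λ x → InClosedNbhd G a w ⇔ (∣ x - X w ∣ ≤ K)) Xa≡ (closedNbhd⇔near a w))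

module _ {n : ℕ} {G : Graph n} {K : ℕ} {_≺_ : Fin n → Fin n → Set}
         (≺⇒distinguishable : ∀ {u v} → u ≺ v → ¬ Indistinguishable G u v)
         (comparable : ∀ {u v} → u ≢ v → ¬ Adj G u v → u ≺ v ⊎ v ≺ u)
         {X : Fin n → ℤ} (rep : IsScaledRep G K X) (mono : X Preserves _≺_ ⟶ _<_) where

  shiftLeft-monotone : ∀ {u} → (∀ w → ¬ Jump K X u w) → shiftLeft X u Preserves _≺_ ⟶ _<_
  shiftLeft-monotone {u} unblocked {a} {b} a≺b with a Fin.≟ u | b Fin.≟ u
  ... | yes refl | yes refl = ⊥-elim (ℤ.<-irrefl refl (mono a≺b))
  ... | yes refl | no b≢u rewrite shiftLeft-self X u | shiftLeft-other X b≢u =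
    ℤ.<-trans (pred<self (X u)) (mono a≺b)
  ... | no a≢u | yes refl rewrite shiftLeft-self X u | shiftLeft-other X a≢u =
    ℤ.≤∧≢⇒< (ℤ.i<j⇒i≤pred[j] (mono a≺b))
      (≺⇒distinguishable a≺b ∘ unblocked⇒indistinguishable G K rep unblocked)
  ... | no a≢u | no b≢u rewrite shiftLeft-other X a≢u | shiftLeft-other X b≢u = mono a≺b

  module _ {X' : Fin n → ℤ} (rep' : IsScaledRep G K X') (mono' : X' Preserves _≺_ ⟶ _<_)
           (X'≤X : ∀ v → X' v ℤ.≤ X v) where

    Moved : Fin n → Set
    Moved v = X' v < X v

    -- uw has length exactly K in X; if w stayed while u moved left, uw would be longer than K in X'.
    rightJump-moves : ∀ {u w} → Moved u → X w ≡ X u + + K → X' w ≢ X w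
    rightJump-moves {u} {w} moved-u Xw≡Xu+K X'w≡Xw with w Fin.≟ u
    ... | yes refl = ℤ.<-irrefl X'w≡Xw moved-u
    ... | no w≢u =
      ℤ.<⇒≱ (Equivalence.to (∣-∣≤⇔<+1+ K X'u≤X'w) (Equivalence.to (rep' u w u≢w) u~w)) X'u+1+K≤X'w
      where
      u≢w : u ≢ w
      u≢w = w≢u ∘ sym
      Xu≤Xw : X u ℤ.≤ X w
      Xu≤Xw = subst (X u ℤ.≤_) (sym Xw≡Xu+K) (ℤ.i≤i+j (X u) (+ K))
      u~w : Adj G u w
      u~w = Equivalence.from (rep u w u≢w) (Equivalence.from (∣-∣≤⇔<+1+ K Xu≤Xw)
        (subst (_< X u + + suc K) (sym Xw≡Xu+K) (ℤ.+-monoʳ-< (X u) (ℤ.+<+ (ℕ.n<1+n K)))))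
      X'u≤X'w : X' u ℤ.≤ X' w
      X'u≤X'w = ℤ.≤-trans (ℤ.<⇒≤ moved-u) (subst (X u ℤ.≤_) (sym X'w≡Xw) Xu≤Xw)
      X'u+1+K≤X'w : X' u + + suc K ℤ.≤ X' w
      X'u+1+K≤X'w = subst₂ ℤ._≤_ (shuffle (X' u) (+ K)) (sym (trans X'w≡Xw Xw≡Xu+K))
        (ℤ.+-monoˡ-≤ (+ K) (ℤ.i<j⇒suc[i]≤j moved-u))
        where
        shuffle : ∀ x k → (1ℤ + x) + k ≡ x + (1ℤ + k)
        shuffle = solve-∀

    -- u and w are at distance K+1, so non-adjacent, hence w ≺ u; if w stayed, u would come
    -- within distance K of it.
    leftJump-moves : ∀ {u w} → Moved u → X w ≡ X u - + suc K → X' w ≢ X w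
    leftJump-moves {u} {w} moved-u Xw≡Xu-1-K X'w≡Xw =
      [ ℤ.<-asym Xw<Xu ∘ mono , w≁u ∘ close ∘ mono' ] (comparable u≢w u≁w)
      where
      Xw+1+K≡Xu : X w + + suc K ≡ X u
      Xw+1+K≡Xu = trans (cong (_+ + suc K) Xw≡Xu-1-K) (sub-add (X u) (+ suc K))
        where
        sub-add : ∀ x k → (x - k) + k ≡ x
        sub-add = solve-∀
      Xw<Xu : X w < X u
      Xw<Xu = subst (X w <_) Xw+1+K≡Xu (<+1+ (X w) K)
      u≢w : u ≢ w
      u≢w refl = ℤ.<-irrefl refl Xw<Xu
      w≁u : ¬ Adj G w u
      w≁u w~u = ℤ.<-irrefl (sym Xw+1+K≡Xu)
        (Equivalence.to (∣-∣≤⇔<+1+ K (ℤ.<⇒≤ Xw<Xu)) (Equivalence.to (rep w u (u≢w ∘ sym)) w~u))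
      u≁w : ¬ Adj G u w
      u≁w = w≁u ∘ Graph.sym G
      close : X' w < X' u → Adj G w u
      close X'w<X'u = Equivalence.from (rep' w u (u≢w ∘ sym))
        (Equivalence.from (∣-∣≤⇔<+1+ K (ℤ.<⇒≤ X'w<X'u))
          (subst (X' u <_) (trans (sym Xw+1+K≡Xu) (cong (_+ + suc K) (sym X'w≡Xw))) moved-u))

    jump-preserves-moved : ∀ {u w} → Moved u → Jump K X u w → Moved w
    jump-preserves-moved {u} {w} moved-u jump with X' w ℤ.<? X w
    ... | yes moved-w = moved-w
    ... | no unmoved =
      ⊥-elim ([ rightJump-moves moved-u , leftJump-moves moved-u ]′ jump (ℤ.≤∧≮⇒≡ (X'≤X w) unmoved))

    moved-unblocked : n ≤ 2 * K → ∀ {v} → Moved v → ∃[ u ] Moved u × (∀ w → ¬ Jump K X u w)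
    moved-unblocked n≤2K {v} moved-v with Fin.any? (λ u → (X' u ℤ.<? X u) ×-dec ¬? (Fin.any? (jump? K X u)))
    ... | yes (u , moved-u , no-jump) = u , moved-u , λ w jump → no-jump (w , jump)
    ... | no none = ⊥-elim (jumpClosed-empty K X Moved n≤2K closed v moved-v)
      where
      closed : ∀ u → Moved u → ∃[ w ] Moved w × Jump K X u w
      closed u moved-u with Fin.any? (jump? K X u)
      ... | yes (w , jump) = w , jump-preserves-moved moved-u jump , jump
      ... | no no-jump = ⊥-elim (none (u , moved-u , no-jump))

nonadjacent⇒distinguishable : ∀ {n} (G : Graph n) {u v} → u ≢ v → ¬ Adj G u v → ¬ Indistinguishable G u v
nonadjacent⇒distinguishable G {v = v} u≢v u≁v indist =
  [ u≢v ∘ sym , u≁v ] (Equivalence.from (indist v) (inj₁ refl))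

∣q-q∣≤1 : ∀ q → ℚ.∣ q ℚ.- q ∣ ℚ.≤ 1ℚ
∣q-q∣≤1 q = subst (λ p → ℚ.∣ p ∣ ℚ.≤ 1ℚ) (sym (ℚ.+-inverseʳ q)) (ℚ.*≤* (ℤ.+≤+ z≤n))

module _ {n : ℕ} {G : Graph n} {_≺_ : Fin n → Fin n → Set} (order : IsIntervalOrder G _≺_) where

  private
    ℓ₀ : Fin n → ℚ
    ℓ₀ = proj₁ order

    rep₀ : IsUnitIntervalRep G ℓ₀
    rep₀ = proj₁ (proj₂ order)

    ≺⇔ : ∀ u v → (u ≺ v) ⇔ ((¬ Indistinguishable G u v) × (ℓ₀ u ℚ.< ℓ₀ v))
    ≺⇔ = proj₂ (proj₂ order)

  ≺⇒distinguishable : ∀ {u v} → u ≺ v → ¬ Indistinguishable G u v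
  ≺⇒distinguishable {u} {v} = proj₁ ∘ Equivalence.to (≺⇔ u v)

  comparable : ∀ {u v} → u ≢ v → ¬ Adj G u v → u ≺ v ⊎ v ≺ u
  comparable {u} {v} u≢v u≁v with ℚ.<-cmp (ℓ₀ u) (ℓ₀ v)
  ... | tri< ℓ₀u<ℓ₀v _ _ = inj₁ (Equivalence.from (≺⇔ u v)
    (nonadjacent⇒distinguishable G u≢v u≁v , ℓ₀u<ℓ₀v))
  ... | tri≈ _ ℓ₀u≡ℓ₀v _ = ⊥-elim (u≁v (Equivalence.from (rep₀ u v u≢v)
    (subst (λ p → ℚ.∣ p ℚ.- ℓ₀ v ∣ ℚ.≤ 1ℚ) (sym ℓ₀u≡ℓ₀v) (∣q-q∣≤1 (ℓ₀ v)))))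
  ... | tri> _ _ ℓ₀v<ℓ₀u = inj₂ (Equivalence.from (≺⇔ v u)
    (nonadjacent⇒distinguishable G (u≢v ∘ sym) (u≁v ∘ Graph.sym G) , ℓ₀v<ℓ₀u))

module _ {n : ℕ} {G : Graph n} {K : ℕ} .{{_ : NonZero K}} where

  aboveLBound-mono : ∀ {b p q} → p ℚ.≤ q → AboveLBound G K b p → AboveLBound G K b q
  aboveLBound-mono {nothing} _ _ = tt
  aboveLBound-mono {just b} p≤q b≤p = ℚ.≤-trans b≤p p≤q

  module _ {ℓ : Fin n → ℚ} (X : Fin n → ℤ) (ℓ≡X/K : ∀ v → ℓ v ≡ X v / K) where

    unitIntervalRep⇔scaledRep : IsUnitIntervalRep G ℓ ⇔ IsScaledRep G K X
    unitIntervalRep⇔scaledRep = mk⇔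
      (λ rep u v u≢v → distance⇔ u v ⇔-∘ rep u v u≢v)
      (λ rep u v u≢v → ⇔-sym (distance⇔ u v) ⇔-∘ rep u v u≢v)
      where
      distance⇔ : ∀ u v → (ℚ.∣ ℓ u ℚ.- ℓ v ∣ ℚ.≤ 1ℚ) ⇔ (∣ X u - X v ∣ ≤ K)
      distance⇔ u v rewrite ℓ≡X/K u | ℓ≡X/K v = ∣/-/∣≤1⇔∣-∣≤K K (X u) (X v)

    ordered⇔monotone : ∀ {_≺_ : Fin n → Fin n → Set} →
                       (∀ u v → u ≺ v → ℓ u ℚ.< ℓ v) ⇔ (X Preserves _≺_ ⟶ _<_)
    ordered⇔monotone = mk⇔
      (λ ord {u} {v} u≺v → Equivalence.to (/-<⇔ K (ℓ≡X/K u) (ℓ≡X/K v)) (ord u v u≺v))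
      (λ mono u v u≺v → Equivalence.from (/-<⇔ K (ℓ≡X/K u) (ℓ≡X/K v)) (mono u≺v))

  module _ {_≺_ : Fin n → Fin n → Set} {lbound : Fin n → Maybe ℚ} where

    leftShift⇒predecessor : ∀ {ℓ ℓ'} → IsGrid G K ℓ → IsLeftShift G K ℓ' ℓ →
                            IsPredecessor G K _≺_ lbound ℓ' ℓ
    leftShift⇒predecessor {ℓ} {ℓ'} grid (u , ℓ'u≡ℓu-ε , ℓ'v≡ℓv) = (ℓ'≤ℓ , ℓ'≢ℓ) , nothing-between
      where
      X : Fin n → ℤ
      X v = proj₁ (grid v)
      ℓ≡X/K : ∀ v → ℓ v ≡ X v / K
      ℓ≡X/K v = proj₂ (grid v)
      ℓ'u≡ : ℓ' u ≡ predℤ (X u) / K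
      ℓ'u≡ = trans ℓ'u≡ℓu-ε (trans (cong (ℚ._- ε G K) (ℓ≡X/K u)) (/-pred K (X u)))
      ℓ'≤ℓ : ∀ v → ℓ' v ℚ.≤ ℓ v
      ℓ'≤ℓ v with v Fin.≟ u
      ... | yes refl = Equivalence.from (/-≤⇔ K ℓ'u≡ (ℓ≡X/K v)) (ℤ.<⇒≤ (pred<self (X v)))
      ... | no v≢u = ℚ.≤-reflexive (ℓ'v≡ℓv v v≢u)
      ℓ'≢ℓ : ¬ (∀ v → ℓ' v ≡ ℓ v)
      ℓ'≢ℓ ℓ'≡ℓ =
        ℤ.<-irrefl (/-injective K (trans (sym ℓ'u≡) (trans (ℓ'≡ℓ u) (ℓ≡X/K u)))) (pred<self (X u))
      nothing-between : ¬ (∃[ m ] InRep G K _≺_ lbound m × _<ᴿ_ G K ℓ' m × _<ᴿ_ G K m ℓ)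
      nothing-between (m , (gridₘ , _) , (ℓ'≤m , ℓ'≢m) , (m≤ℓ , m≢ℓ)) =
        [ ℓ'≢m ∘ ℓ'≡m , m≢ℓ ∘ m≡ℓ ] (between-pred-and-self lo hi)
        where
        Z : Fin n → ℤ
        Z v = proj₁ (gridₘ v)
        m≡Z/K : ∀ v → m v ≡ Z v / K
        m≡Z/K v = proj₂ (gridₘ v)
        lo : predℤ (X u) ℤ.≤ Z u
        lo = Equivalence.to (/-≤⇔ K ℓ'u≡ (m≡Z/K u)) (ℓ'≤m u)
        hi : Z u ℤ.≤ X u
        hi = Equivalence.to (/-≤⇔ K (m≡Z/K u) (ℓ≡X/K u)) (m≤ℓ u)
        squeeze : ∀ v → v ≢ u → m v ≡ ℓ v
        squeeze v v≢u = ℚ.≤-antisym (m≤ℓ v) (subst (ℚ._≤ m v) (ℓ'v≡ℓv v v≢u) (ℓ'≤m v))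
        ℓ'≡m : Z u ≡ predℤ (X u) → ∀ v → ℓ' v ≡ m v
        ℓ'≡m Zu≡ v with v Fin.≟ u
        ... | yes refl = trans ℓ'u≡ (trans (cong (_/ K) (sym Zu≡)) (sym (m≡Z/K v)))
        ... | no v≢u = trans (ℓ'v≡ℓv v v≢u) (sym (squeeze v v≢u))
        m≡ℓ : Z u ≡ X u → ∀ v → m v ≡ ℓ v
        m≡ℓ Zu≡ v with v Fin.≟ u
        ... | yes refl = trans (m≡Z/K v) (trans (cong (_/ K) Zu≡) (sym (ℓ≡X/K v)))
        ... | no v≢u = squeeze v v≢u

    module _ (order : IsIntervalOrder G _≺_) {ℓ ℓ' : Fin n → ℚ}
             (Rℓ : InRep G K _≺_ lbound ℓ) (Rℓ' : InRep G K _≺_ lbound ℓ')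
             (ℓ'≤ℓ : _≤ᴿ_ G K ℓ' ℓ) where

      private
        X X' : Fin n → ℤ
        X v = proj₁ (proj₁ Rℓ v)
        X' v = proj₁ (proj₁ Rℓ' v)

        ℓ≡X/K : ∀ v → ℓ v ≡ X v / K
        ℓ≡X/K v = proj₂ (proj₁ Rℓ v)

        ℓ'≡X'/K : ∀ v → ℓ' v ≡ X' v / K
        ℓ'≡X'/K v = proj₂ (proj₁ Rℓ' v)

        rep : IsScaledRep G K X
        rep = Equivalence.to (unitIntervalRep⇔scaledRep X ℓ≡X/K) (proj₁ (proj₂ Rℓ))

        rep' : IsScaledRep G K X'
        rep' = Equivalence.to (unitIntervalRep⇔scaledRep X' ℓ'≡X'/K) (proj₁ (proj₂ Rℓ'))

        mono : X Preserves _≺_ ⟶ _<_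
        mono = Equivalence.to (ordered⇔monotone X ℓ≡X/K) (proj₁ (proj₂ (proj₂ Rℓ)))

        mono' : X' Preserves _≺_ ⟶ _<_
        mono' = Equivalence.to (ordered⇔monotone X' ℓ'≡X'/K) (proj₁ (proj₂ (proj₂ Rℓ')))

        X'≤X : ∀ v → X' v ℤ.≤ X v
        X'≤X v = Equivalence.to (/-≤⇔ K (ℓ'≡X'/K v) (ℓ≡X/K v)) (ℓ'≤ℓ v)

        shifted : Fin n → Fin n → ℚ
        shifted u v = shiftLeft X u v / K

        some-moved : ¬ (∀ v → ℓ' v ≡ ℓ v) → ∃[ v ] X' v < X v
        some-moved ℓ'≢ℓ with Fin.¬∀⟶∃¬ n _ (λ v → ℓ' v ℚ.≟ ℓ v) ℓ'≢ℓ
        ... | v , ℓ'v≢ℓv = v , ℤ.≤∧≢⇒< (X'≤X v)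
          (λ X'v≡Xv → ℓ'v≢ℓv (trans (ℓ'≡X'/K v) (trans (cong (_/ K) X'v≡Xv) (sym (ℓ≡X/K v)))))

      shifted-between : ∀ {u} → X' u < X u → (∀ w → ¬ Jump K X u w) →
                        InRep G K _≺_ lbound (shifted u) × _≤ᴿ_ G K ℓ' (shifted u) × _<ᴿ_ G K (shifted u) ℓ
      shifted-between {u} moved unblocked =
        (grid , rep-shifted , ordered , above) , ℓ'≤shifted , (shifted≤ℓ , shifted≢ℓ)
        where
        grid : IsGrid G K (shifted u)
        grid v = shiftLeft X u v , refl
        rep-shifted : IsUnitIntervalRep G (shifted u)
        rep-shifted = Equivalence.from (unitIntervalRep⇔scaledRep (shiftLeft X u) (λ _ → refl))
          (shiftLeft-isScaledRep G K rep unblocked)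
        ordered : ∀ a b → a ≺ b → shifted u a ℚ.< shifted u b
        ordered = Equivalence.from (ordered⇔monotone (shiftLeft X u) (λ _ → refl))
          (shiftLeft-monotone {G = G} (≺⇒distinguishable {G = G} order) (comparable {G = G} order)
                              rep mono unblocked)
        X'≤shiftLeft : ∀ v → X' v ℤ.≤ shiftLeft X u v
        X'≤shiftLeft v with v Fin.≟ u
        ... | yes refl rewrite shiftLeft-self X v = ℤ.i<j⇒i≤pred[j] moved
        ... | no v≢u rewrite shiftLeft-other X v≢u = X'≤X v
        ℓ'≤shifted : ∀ v → ℓ' v ℚ.≤ shifted u v
        ℓ'≤shifted v = Equivalence.from (/-≤⇔ K (ℓ'≡X'/K v) refl) (X'≤shiftLeft v)
        above : ∀ v → AboveLBound G K (lbound v) (shifted u v)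
        above v = aboveLBound-mono (ℓ'≤shifted v) (proj₂ (proj₂ (proj₂ Rℓ')) v)
        shifted≤ℓ : ∀ v → shifted u v ℚ.≤ ℓ v
        shifted≤ℓ v = Equivalence.from (/-≤⇔ K refl (ℓ≡X/K v)) (shiftLeft-≤ X u v)
        shifted≢ℓ : ¬ (∀ v → shifted u v ≡ ℓ v)
        shifted≢ℓ shifted≡ℓ = ℤ.<-irrefl
          (trans (sym (shiftLeft-self X u)) (/-injective K (trans (shifted≡ℓ u) (ℓ≡X/K u))))
          (pred<self (X u))

      predecessor⇒leftShift : n ≤ 2 * K → ¬ (∀ v → ℓ' v ≡ ℓ v) →
                              ¬ (∃[ m ] InRep G K _≺_ lbound m × _<ᴿ_ G K ℓ' m × _<ᴿ_ G K m ℓ) →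
                              IsLeftShift G K ℓ' ℓ
      predecessor⇒leftShift n≤2K ℓ'≢ℓ nothing-between
        with moved-unblocked {G = G} (≺⇒distinguishable {G = G} order) (comparable {G = G} order)
                             rep mono rep' mono' X'≤X n≤2K (proj₂ (some-moved ℓ'≢ℓ))
      ... | u , moved , unblocked with shifted-between moved unblocked
      ...   | Rshifted , ℓ'≤shifted , shifted<ℓ = u , ℓ'u≡ℓu-ε , ℓ'v≡ℓv
        where
        ℓ'≡shifted : ∀ v → ℓ' v ≡ shifted u v
        ℓ'≡shifted = decidable-stable (Fin.all? (λ v → ℓ' v ℚ.≟ shifted u v))
          (λ ℓ'≢shifted → nothing-between (shifted u , Rshifted , (ℓ'≤shifted , ℓ'≢shifted) , shifted<ℓ))
        ℓ'u≡ℓu-ε : ℓ' u ≡ ℓ u ℚ.- ε G K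
        ℓ'u≡ℓu-ε = trans (ℓ'≡shifted u) (trans (cong (_/ K) (shiftLeft-self X u))
          (trans (sym (/-pred K (X u))) (cong (ℚ._- ε G K) (sym (ℓ≡X/K u)))))
        ℓ'v≡ℓv : ∀ v → v ≢ u → ℓ' v ≡ ℓ v
        ℓ'v≡ℓv v v≢u = trans (ℓ'≡shifted v) (trans (cong (_/ K) (shiftLeft-other X v≢u)) (sym (ℓ≡X/K v)))

mainTheorem8 : (n : ℕ) (G : Graph n) → Connected G →
    (lbound : Fin n → Maybe ℚ) →
    (K : ℕ) .{{_ : NonZero K}} → n ≤ 2 * K →
    (_≺_ : Fin n → Fin n → Set) → IsIntervalOrder G _≺_ →
    (ℓ ℓ' : Fin n → ℚ) →
    InRep G K _≺_ lbound ℓ → InRep G K _≺_ lbound ℓ' →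
    IsPredecessor G K _≺_ lbound ℓ' ℓ ⇔ IsLeftShift G K ℓ' ℓ
mainTheorem8 n G _ lbound K n≤2K _≺_ order ℓ ℓ' Rℓ Rℓ' = mk⇔
  (λ { ((ℓ'≤ℓ , ℓ'≢ℓ) , nothing-between) →
        predecessor⇒leftShift {G = G} order Rℓ Rℓ' ℓ'≤ℓ n≤2K ℓ'≢ℓ nothing-between })
  (leftShift⇒predecessor {G = G} (proj₁ Rℓ))
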